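{- For every integer $n\ge 1$, the map $\mathcal I^C_{2n}(321)\to 2^{[n]}$ sending $\pi\mapsto E_\pi$ is a bijection. In particular, elements of $\mathcal I^C_{2n}(321)$ are uniquely determined by their excedances in $[n]$.
   Context: $[n]=\{1,\dots,n\}$ and $2^{[n]}$ is the family of all subsets of $[n]$. A permutation $\pi\in\mathcal S_m$ is centrosymmetric if $\pi(i)+\pi(m+1-i)=m+1$ for all $1\le i\le m$. $\mathcal I^C_m(321)$ denotes the set of centrosymmetric involutions in $\mathcal S_m$ that avoid the pattern $321$ (i.e., contain no indices $i<j<k$ with $\pi(i)>\pi(j)>\pi(k)$). An excedance of $\pi$ is a position $i$ with $\pi(i)>i$; $\mathrm{Exc}(\pi)$ is the set of excedances. For $\pi\in\mathcal I^C_{2n}(321)$, $E_\pi=\mathrm{Exc}(\pi)\cap[n]$. -}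

module Defs where

open import Data.Nat using (ℕ; _+_)
open import Data.Fin using (Fin; opposite; _↑ˡ_; toℕ; _<_; _<?_)
open import Data.Fin.Permutation using (Permutation′; _⟨$⟩ʳ_)
open import Data.Fin.Subset using (Subset)
open import Data.Vec using (tabulate)
open import Data.Product using (Σ; _×_; ∃-syntax)
open import Relation.Nullary using (¬_; does)
open import Relation.Binary.PropositionalEquality using (_≡_)

-- A permutation of [m] (as Fin m, positions 0..m-1 stand for 1..m).
-- Centrosymmetric: π(m+1-i) = m+1-π(i), i.e. π (opposite i) = opposite (π i).
Centrosymmetric : ∀ {m} → Permutation′ m → Set
Centrosymmetric π = ∀ i → π ⟨$⟩ʳ (opposite i) ≡ opposite (π ⟨$⟩ʳ i)

Involution : ∀ {m} → Permutation′ m → Set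
Involution π = ∀ i → π ⟨$⟩ʳ (π ⟨$⟩ʳ i) ≡ i

Contains321 : ∀ {m} → Permutation′ m → Set
Contains321 {m} π = ∃[ i ] ∃[ j ] ∃[ k ]
  (i < j × j < k × π ⟨$⟩ʳ j < π ⟨$⟩ʳ i × π ⟨$⟩ʳ k < π ⟨$⟩ʳ j)

Avoids321 : ∀ {m} → Permutation′ m → Set
Avoids321 π = ¬ Contains321 π

InIC321 : ∀ {m} → Permutation′ m → Set
InIC321 π = Centrosymmetric π × Involution π × Avoids321 π

-- E_π = Exc(π) ∩ [n] for π ∈ S_{2n} (2n written n + n), as a subset of [n].
-- Position i ∈ [n] is an excedance iff i < π(i).
Eπ : ∀ n → Permutation′ (n + n) → Subset n
Eπ n π = tabulate (λ i → does ((i ↑ˡ n) <? π ⟨$⟩ʳ (i ↑ˡ n)))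

-- Read the positions of a permutation from left to right: an excedance opens an arc and a
-- deficiency closes one. For a 321-avoiding involution the arcs cannot nest, so the k-th
-- opener is matched with the k-th closer, and a non-excedance is a closer exactly when more
-- arcs have been opened than closed before it. Hence the excedances determine the whole
-- involution once they are known everywhere, and centrosymmetry, which exchanges excedances
-- and deficiencies under i ↦ 2n + 1 − i, recovers them on the upper half from the lower half.
-- Conversely, for S ⊆ [n] open an arc at each element of S, close a pending arc at every
-- other position of [n], and complete the word to [2n] by its mirror image; matching the
-- k-th opener with the k-th closer gives a centrosymmetric 321-avoiding involution with
-- E_π = S.

module Submission where

open import Data.Bool using (Bool; true; false; T; not; _∧_; _∨_; if_then_else_)
open import Data.Bool.Properties using (T-≡; ∧-idem; ∧-distribˡ-∨)
import Data.Bool.Properties as B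
open import Data.Empty using (⊥; ⊥-elim)
open import Data.Fin as Fin using (Fin; toℕ; fromℕ<; opposite; _↑ˡ_)
open import Data.Fin.Permutation using (Permutation′; _⟨$⟩ʳ_; permutation)
open import Data.Fin.Properties using (toℕ-fromℕ<; fromℕ<-toℕ; toℕ-injective; toℕ<n; opposite-prop; toℕ-↑ˡ)
open import Data.Fin.Subset using (Subset)
open import Data.Nat using (ℕ; zero; suc; pred; _+_; _∸_; _≤_; _<_; _<ᵇ_; _≡ᵇ_; _<?_; z≤n; s≤s; s≤s⁻¹; z<s)
open import Data.Nat.Induction using (<-rec)
open import Data.Nat.Properties
open import Algebra.Properties.CommutativeSemigroup +-commutativeSemigroup using (interchange)
open import Data.Nat.Solver using (module +-*-Solver)
open import Data.Product using (_×_; _,_; ∃-syntax)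
open import Data.Sum using (inj₁; inj₂)
open import Data.Vec using (Vec; []; _∷_; lookup)
open import Data.Vec.Properties using (tabulate∘lookup; tabulate-cong; lookup∘tabulate)
open import Function.Bundles using (Equivalence)
open import Relation.Nullary using (yes; no)
open import Relation.Binary.PropositionalEquality
open import Relation.Binary.Definitions using (Tri; tri<; tri≈; tri>)

open import Defs

true≢false : true ≢ false
true≢false ()

∧-trueʳ : ∀ {a b} → (a ∧ b) ≡ true → b ≡ true
∧-trueʳ {true} e = e

bool-pigeonhole : ∀ {a b c : Bool} → a ≢ b → b ≢ c → a ≡ c
bool-pigeonhole {false} {false} a≢b _   = ⊥-elim (a≢b refl)
bool-pigeonhole {true}  {true}  a≢b _   = ⊥-elim (a≢b refl)
bool-pigeonhole {_} {false} {false} _ b≢c = ⊥-elim (b≢c refl)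
bool-pigeonhole {_} {true}  {true}  _ b≢c = ⊥-elim (b≢c refl)
bool-pigeonhole {false} {true}  {false} _ _ = refl
bool-pigeonhole {true}  {false} {true}  _ _ = refl

<ᵇ-true⇒< : ∀ {m n} → (m <ᵇ n) ≡ true → m < n
<ᵇ-true⇒< {m} {n} e = <ᵇ⇒< m n (Equivalence.from T-≡ e)

<⇒<ᵇ-true : ∀ {m n} → m < n → (m <ᵇ n) ≡ true
<⇒<ᵇ-true m<n = Equivalence.to T-≡ (<⇒<ᵇ m<n)

<ᵇ-false⇒≥ : ∀ {m n} → (m <ᵇ n) ≡ false → n ≤ m
<ᵇ-false⇒≥ e = ≮⇒≥ (λ m<n → subst T e (<⇒<ᵇ m<n))

≥⇒<ᵇ-false : ∀ {m n} → n ≤ m → (m <ᵇ n) ≡ false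
≥⇒<ᵇ-false {m} {n} n≤m with m <ᵇ n in e
... | false = refl
... | true  = ⊥-elim (≤⇒≯ n≤m (<ᵇ-true⇒< e))

≡ᵇ-true⇒≡ : ∀ {m n} → (m ≡ᵇ n) ≡ true → m ≡ n
≡ᵇ-true⇒≡ {m} {n} e = ≡ᵇ⇒≡ m n (Equivalence.from T-≡ e)

≡ᵇ-refl : ∀ m → (m ≡ᵇ m) ≡ true
≡ᵇ-refl m = Equivalence.to T-≡ (≡⇒≡ᵇ m m refl)

≡ᵇ-false⇒≢ : ∀ {m n} → (m ≡ᵇ n) ≡ false → m ≢ n
≡ᵇ-false⇒≢ {m} e refl = true≢false (trans (sym (≡ᵇ-refl m)) e)

<ᵇ-split : ∀ p x → (p <ᵇ x) ≡ ((suc p <ᵇ x) ∨ (x ≡ᵇ suc p))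
<ᵇ-split p       zero          = refl
<ᵇ-split zero    (suc zero)    = refl
<ᵇ-split zero    (suc (suc x)) = refl
<ᵇ-split (suc p) (suc x)       = <ᵇ-split p x

<ᵇ-∧-≡ᵇ : ∀ p x → ((p <ᵇ x) ∧ (x ≡ᵇ p)) ≡ false
<ᵇ-∧-≡ᵇ zero    zero    = refl
<ᵇ-∧-≡ᵇ zero    (suc x) = refl
<ᵇ-∧-≡ᵇ (suc p) zero    = refl
<ᵇ-∧-≡ᵇ (suc p) (suc x) = <ᵇ-∧-≡ᵇ p x

∸≡suc∸suc : ∀ {m k} → k < m → m ∸ k ≡ suc (m ∸ suc k)
∸≡suc∸suc {suc m} (s≤s k≤m) = +-∸-assoc 1 k≤m

∸-suc-involutive : ∀ {m q} → q < m → m ∸ suc (m ∸ suc q) ≡ q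
∸-suc-involutive {suc m} (s≤s q≤m) = m∸[m∸n]≡n q≤m

∸-suc-< : ∀ {m q} → q < m → m ∸ suc q < m
∸-suc-< {suc m} {q} _ = s≤s (m∸n≤m m q)

∸-suc-<ᵇ : ∀ {m a b} → a < m → b < m → (m ∸ suc a <ᵇ m ∸ suc b) ≡ (b <ᵇ a)
∸-suc-<ᵇ {m} {a} {b} a<m b<m with b <ᵇ a in e
... | true  = <⇒<ᵇ-true (∸-monoʳ-< (s≤s (<ᵇ-true⇒< e)) a<m)
... | false = ≥⇒<ᵇ-false (∸-monoʳ-≤ m (s≤s (<ᵇ-false⇒≥ e)))

upper-half-mirror : ∀ {n q} → n ≤ q → q < n + n → n + n ∸ suc q < n
upper-half-mirror {n} {q} n≤q q<2n =
  subst (n + n ∸ suc q <_) (m+n∸n≡m n n) (∸-monoʳ-< (s≤s n≤q) q<2n)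

lower-half-mirror : ∀ {n q} → q < n → n ≤ n + n ∸ suc q
lower-half-mirror {n} {q} q<n = subst (_≤ n + n ∸ suc q) (m+n∸n≡m n n) (∸-monoʳ-≤ (n + n) q<n)

-- Counting

𝟙 : Bool → ℕ
𝟙 true  = 1
𝟙 false = 0

count : (ℕ → Bool) → ℕ → ℕ
count P zero    = 0
count P (suc p) = count P p + 𝟙 (P p)

module _ (P : ℕ → Bool) where

  count-true : ∀ {p} → P p ≡ true → count P (suc p) ≡ suc (count P p)
  count-true {p} e rewrite e = +-comm (count P p) 1

  count-mono : ∀ {p p′} → p ≤ p′ → count P p ≤ count P p′
  count-mono {p′ = zero}   z≤n = ≤-refl
  count-mono {p′ = suc p′} p≤sp′ with m≤n⇒m<n∨m≡n p≤sp′
  ... | inj₁ p<sp′ = ≤-trans (count-mono (s≤s⁻¹ p<sp′)) (m≤m+n (count P p′) _)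
  ... | inj₂ refl  = ≤-refl

  count-< : ∀ {a b} → a < b → P a ≡ true → count P a < count P b
  count-< {b = b} a<b e = subst (_≤ count P b) (count-true e) (count-mono a<b)

  count-<⇒< : ∀ {a b} → count P a < count P b → a < b
  count-<⇒< lt = ≰⇒> (λ b≤a → <⇒≱ lt (count-mono b≤a))

  count-≤⇒≤ : ∀ {a b} → P b ≡ true → count P a ≤ count P b → a ≤ b
  count-≤⇒≤ e le = ≮⇒≥ (λ b<a → <⇒≱ (count-< b<a e) le)

  count-injective : ∀ {a b} → P a ≡ true → P b ≡ true → count P a ≡ count P b → a ≡ b
  count-injective ea eb eq =
    ≤-antisym (count-≤⇒≤ eb (≤-reflexive eq)) (count-≤⇒≤ ea (≤-reflexive (sym eq)))

  count-none : ∀ p → (∀ q → q < p → P q ≡ false) → count P p ≡ 0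
  count-none zero    _ = refl
  count-none (suc p) h rewrite h p ≤-refl | count-none p (λ q q<p → h q (m<n⇒m<1+n q<p)) = refl

  count-single : ∀ p q₀ → P q₀ ≡ true → q₀ < p → (∀ q → q < p → P q ≡ true → q ≡ q₀) →
    count P p ≡ 1
  count-single (suc p) q₀ e q₀<sp h with m≤n⇒m<n∨m≡n (s≤s⁻¹ q₀<sp)
  ... | inj₂ refl rewrite e = cong (_+ 1) (count-none q₀ below)
    where
    below : ∀ q → q < q₀ → P q ≡ false
    below q q<q₀ with P q in eq
    ... | false = refl
    ... | true  = ⊥-elim (<⇒≢ q<q₀ (h q (m<n⇒m<1+n q<q₀) eq))
  ... | inj₁ q₀<p with P p in eq
  ... | true  = ⊥-elim (<⇒≢ q₀<p (sym (h p ≤-refl eq)))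
  ... | false = trans (+-identityʳ _) (count-single p q₀ e q₀<p (λ q q<p → h q (m<n⇒m<1+n q<p)))

  count-cong : ∀ {Q} p → (∀ q → q < p → P q ≡ Q q) → count P p ≡ count Q p
  count-cong zero    _ = refl
  count-cong (suc p) h =
    cong₂ _+_ (count-cong p (λ q q<p → h q (m<n⇒m<1+n q<p))) (cong 𝟙 (h p ≤-refl))

𝟙-∨ : ∀ a b → (a ∧ b) ≡ false → 𝟙 (a ∨ b) ≡ 𝟙 a + 𝟙 b
𝟙-∨ true  false _ = refl
𝟙-∨ false b     _ = refl

count-∨ : ∀ R P Q p → (∀ q → q < p → R q ≡ (P q ∨ Q q)) → (∀ q → q < p → (P q ∧ Q q) ≡ false)
  → count R p ≡ count P p + count Q p
count-∨ R P Q zero    _ _ = refl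
count-∨ R P Q (suc p) R≡P∨Q disjoint = trans
  (cong₂ _+_ (count-∨ R P Q p (λ q q<p → R≡P∨Q q (m<n⇒m<1+n q<p)) (λ q q<p → disjoint q (m<n⇒m<1+n q<p)))
             (trans (cong 𝟙 (R≡P∨Q p ≤-refl)) (𝟙-∨ (P p) (Q p) (disjoint p ≤-refl))))
  (interchange (count P p) (count Q p) (𝟙 (P p)) (𝟙 (Q p)))

count-mirror : ∀ P Q m → (∀ q → q < m → P q ≡ Q (m ∸ suc q))
  → ∀ k → k ≤ m → count P k + count Q (m ∸ k) ≡ count Q m
count-mirror P Q m _ zero _ = refl
count-mirror P Q m P≡Q (suc k) sk≤m = begin
  count P k + 𝟙 (P k) + count Q j   ≡⟨ +-assoc (count P k) _ _ ⟩
  count P k + (𝟙 (P k) + count Q j) ≡⟨ cong (λ b → count P k + (𝟙 b + count Q j)) (P≡Q k sk≤m) ⟩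
  count P k + (𝟙 (Q j) + count Q j) ≡⟨ cong (count P k +_) (+-comm _ (count Q j)) ⟩
  count P k + count Q (suc j)       ≡⟨ cong (λ x → count P k + count Q x) (sym (∸≡suc∸suc sk≤m)) ⟩
  count P k + count Q (m ∸ k)       ≡⟨ count-mirror P Q m P≡Q k (≤-trans (n≤1+n k) sk≤m) ⟩
  count Q m                         ∎
  where
  open ≡-Reasoning
  j : ℕ
  j = m ∸ suc k

nth : (ℕ → Bool) → ℕ → ℕ → ℕ
nth P k zero    = zero
nth P k (suc m) = if P m ∧ (count P m ≡ᵇ k) then m else nth P k m

record IsNth (P : ℕ → Bool) (k m q : ℕ) : Set where
  field
    bounded : q < m
    holds   : P q ≡ true
    rank    : count P q ≡ k

IsNth-suc : ∀ {P k m q} → IsNth P k m q → IsNth P k (suc m) q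
IsNth-suc r = record { IsNth r ; bounded = m<n⇒m<1+n (IsNth.bounded r) }

nth-isNth : ∀ P k m → k < count P m → IsNth P k m (nth P k m)
nth-isNth P k (suc m) k<count with P m in e | count P m ≡ᵇ k in e′
... | true  | true  = record { bounded = ≤-refl ; holds = e ; rank = ≡ᵇ-true⇒≡ e′ }
... | true  | false = IsNth-suc (nth-isNth P k m k<count′)
  where
  k<count′ : k < count P m
  k<count′ = ≤∧≢⇒< (s≤s⁻¹ (subst (k <_) (+-comm (count P m) 1) k<count))
                    (λ k≡c → ≡ᵇ-false⇒≢ e′ (sym k≡c))
... | false | _     = IsNth-suc (nth-isNth P k m (subst (k <_) (+-identityʳ _) k<count))

-- Centrosymmetric 321-avoiding involutions and their excedances

-- Positions are 0-based, so the mirror image of q in [0, m) is m ∸ suc q.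
record IsIC321 (m : ℕ) (f : ℕ → ℕ) : Set where
  field
    bounded         : ∀ q → q < m → f q < m
    involutive      : ∀ q → q < m → f (f q) ≡ q
    centrosymmetric : ∀ q → q < m → f (m ∸ suc q) ≡ m ∸ suc (f q)
    avoids-321      : ∀ i j k → i < j → j < k → k < m → f j < f i → f k < f j → ⊥

excedance deficiency : (ℕ → ℕ) → ℕ → Bool
excedance  f q = q <ᵇ f q
deficiency f q = f q <ᵇ q

excedance⇒¬deficiency : ∀ f q → excedance f q ≡ true → deficiency f q ≡ false
excedance⇒¬deficiency f q e = ≥⇒<ᵇ-false {f q} (<⇒≤ (<ᵇ-true⇒< e))

fixed-point : ∀ f q → excedance f q ≡ false → deficiency f q ≡ false → f q ≡ q
fixed-point f q e d = ≤-antisym (<ᵇ-false⇒≥ e) (<ᵇ-false⇒≥ d)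

module IC321 {m : ℕ} {f : ℕ → ℕ} (isF : IsIC321 m f) where
  open IsIC321 isF public

  injective : ∀ {a b} → a < m → b < m → f a ≡ f b → a ≡ b
  injective {a} {b} a<m b<m fa≡fb = trans (sym (involutive a a<m)) (trans (cong f fa≡fb) (involutive b b<m))

  deficiency⇒excedance : ∀ q → q < m → deficiency f q ≡ true → excedance f (f q) ≡ true
  deficiency⇒excedance q q<m d = trans (cong (f q <ᵇ_) (involutive q q<m)) d

  excedance⇒deficiency : ∀ q → q < m → excedance f q ≡ true → deficiency f (f q) ≡ true
  excedance⇒deficiency q q<m e = trans (cong (_<ᵇ f q) (involutive q q<m)) e

  -- Otherwise a, b, f b would be an occurrence of 321.
  <-excedance⇒< : ∀ {a b} → a < b → b < m → excedance f b ≡ true → f a < f b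
  <-excedance⇒< {a} {b} a<b b<m e with <-cmp (f a) (f b)
  ... | tri< fa<fb _ _ = fa<fb
  ... | tri≈ _ fa≡fb _ = ⊥-elim (<⇒≢ a<b (injective (<-trans a<b b<m) b<m fa≡fb))
  ... | tri> _ _ fb<fa = ⊥-elim (avoids-321 a b (f b) a<b (<ᵇ-true⇒< e) (bounded b b<m) fb<fa
                           (subst (_< f b) (sym (involutive b b<m)) (<ᵇ-true⇒< e)))

  excedance-mirror : ∀ q → q < m → excedance f (m ∸ suc q) ≡ deficiency f q
  excedance-mirror q q<m = trans (cong (m ∸ suc q <ᵇ_) (centrosymmetric q q<m)) (∸-suc-<ᵇ q<m (bounded q q<m))

  deficiency-mirror : ∀ q → q < m → deficiency f (m ∸ suc q) ≡ excedance f q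
  deficiency-mirror q q<m = trans (cong (_<ᵇ m ∸ suc q) (centrosymmetric q q<m)) (∸-suc-<ᵇ (bounded q q<m) q<m)

  arc-over arc-to : ℕ → ℕ → Bool
  arc-over p a = excedance f a ∧ (p <ᵇ f a)
  arc-to   p a = excedance f a ∧ (f a ≡ᵇ p)

  arcs-over : ℕ → ℕ
  arcs-over p = count (arc-over p) p

  arc-to⇒partner : ∀ {p q} → q < m → arc-to p q ≡ true → q ≡ f p
  arc-to⇒partner {q = q} q<m a = trans (sym (involutive q q<m)) (cong f (≡ᵇ-true⇒≡ (∧-trueʳ a)))

  count-arc-to : ∀ p → p < m → count (arc-to p) p ≡ 𝟙 (deficiency f p)
  count-arc-to p p<m with deficiency f p in d
  ... | true  = count-single (arc-to p) p (f p) partner (<ᵇ-true⇒< d)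
                  (λ q q<p → arc-to⇒partner (<-trans q<p p<m))
    where
    partner : arc-to p (f p) ≡ true
    partner rewrite deficiency⇒excedance p p<m d | involutive p p<m = ≡ᵇ-refl p
  ... | false = count-none (arc-to p) p no-partner
    where
    no-partner : ∀ q → q < p → arc-to p q ≡ false
    no-partner q q<p with arc-to p q in a
    ... | false = refl
    ... | true  = ⊥-elim (true≢false (trans (sym (<⇒<ᵇ-true fp<p)) d))
      where
      fp<p : f p < p
      fp<p = subst (_< p) (arc-to⇒partner (<-trans q<p p<m) a) q<p

  count-arc-over-suc : ∀ p → count (arc-over p) (suc p) ≡ arcs-over (suc p) + count (arc-to (suc p)) (suc p)
  count-arc-over-suc p = count-∨ (arc-over p) (arc-over (suc p)) (arc-to (suc p)) (suc p)
    (λ q _ → trans (cong (excedance f q ∧_) (<ᵇ-split p (f q))) (∧-distribˡ-∨ (excedance f q) _ _))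
    (λ q _ → ∧-disjoint (excedance f q) (<ᵇ-∧-≡ᵇ (suc p) (f q)))
    where
    ∧-disjoint : ∀ x {y z} → (y ∧ z) ≡ false → ((x ∧ y) ∧ (x ∧ z)) ≡ false
    ∧-disjoint false _ = refl
    ∧-disjoint true  e = e

  -- Every excedance below p is closed before p, closed at p, or still open over p.
  excedances-below : ∀ p → p < m →
    count (excedance f) p ≡ count (deficiency f) p + arcs-over p + 𝟙 (deficiency f p)
  excedances-below zero    _     = refl
  excedances-below (suc p) sp<m = begin
    cE p + 𝟙 (E p)                          ≡⟨ cong (_+ 𝟙 (E p)) (excedances-below p (<-trans (n<1+n p) sp<m)) ⟩
    cD p + A p + 𝟙 (D p) + 𝟙 (E p)          ≡⟨ solve 4 (λ a b c e → a :+ b :+ c :+ e := a :+ c :+ (b :+ e))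
                                                 refl (cD p) (A p) (𝟙 (D p)) (𝟙 (E p)) ⟩
    cD (suc p) + (A p + 𝟙 (E p))            ≡⟨ cong (λ b → cD (suc p) + (A p + 𝟙 b)) (sym (∧-idem (E p))) ⟩
    cD (suc p) + count (arc-over p) (suc p) ≡⟨ cong (cD (suc p) +_) (count-arc-over-suc p) ⟩
    cD (suc p) + (A (suc p) + count (arc-to (suc p)) (suc p))
                                            ≡⟨ cong (λ x → cD (suc p) + (A (suc p) + x)) (count-arc-to (suc p) sp<m) ⟩
    cD (suc p) + (A (suc p) + 𝟙 (D (suc p))) ≡⟨ sym (+-assoc (cD (suc p)) _ _) ⟩
    cD (suc p) + A (suc p) + 𝟙 (D (suc p))   ∎
    where
    open ≡-Reasoning
    open +-*-Solver
    E D : ℕ → Bool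
    E = excedance f
    D = deficiency f
    cE cD A : ℕ → ℕ
    cE = count E
    cD = count D
    A = arcs-over

  no-arc-over-fixed-point : ∀ p → p < m → f p ≡ p → arcs-over p ≡ 0
  no-arc-over-fixed-point p p<m fp≡p = count-none (arc-over p) p no-arc
    where
    no-arc : ∀ a → a < p → arc-over p a ≡ false
    no-arc a a<p with excedance f a | p <ᵇ f a in over
    ... | false | _     = refl
    ... | true  | false = refl
    ... | true  | true  = ⊥-elim (avoids-321 a p (f a) a<p (<ᵇ-true⇒< over) (bounded a a<m)
                            (subst (_< f a) (sym fp≡p) (<ᵇ-true⇒< over))
                            (subst₂ _<_ (sym (involutive a a<m)) (sym fp≡p) a<p))
      where
      a<m : a < m
      a<m = <-trans a<p p<m

  deficiency-by-counts : ∀ p → p < m → excedance f p ≡ false →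
    deficiency f p ≡ (count (deficiency f) p <ᵇ count (excedance f) p)
  deficiency-by-counts p p<m e with deficiency f p in d
  ... | true  = sym (<⇒<ᵇ-true (≤-<-trans (m≤m+n cD (arcs-over p))
                                (subst (cD + arcs-over p <_) (sym counts) (m<m+n _ z<s))))
    where
    cD : ℕ
    cD = count (deficiency f) p
    counts : count (excedance f) p ≡ cD + arcs-over p + 1
    counts = subst (λ b → count (excedance f) p ≡ cD + arcs-over p + 𝟙 b) d (excedances-below p p<m)
  ... | false = sym (≥⇒<ᵇ-false (≤-reflexive counts))
    where
    counts : count (excedance f) p ≡ count (deficiency f) p
    counts = begin
      count (excedance f) p                                   ≡⟨ excedances-below p p<m ⟩
      count (deficiency f) p + arcs-over p + 𝟙 (deficiency f p) ≡⟨ cong₂ (λ a b → count (deficiency f) p + a + 𝟙 b)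
                                                                     (no-arc-over-fixed-point p p<m (fixed-point f p e d)) d ⟩
      count (deficiency f) p + 0 + 0                           ≡⟨ trans (+-identityʳ _) (+-identityʳ _) ⟩
      count (deficiency f) p                                   ∎
      where open ≡-Reasoning

-- Determination by the excedances

record SameLetters (m : ℕ) (f g : ℕ → ℕ) : Set where
  field
    same-excedance  : ∀ q → q < m → excedance f q ≡ excedance g q
    same-deficiency : ∀ q → q < m → deficiency f q ≡ deficiency g q

SameLetters-sym : ∀ {m f g} → SameLetters m f g → SameLetters m g f
SameLetters-sym same = record
  { same-excedance  = λ q q<m → sym (same-excedance q q<m)
  ; same-deficiency = λ q q<m → sym (same-deficiency q q<m)
  }
  where open SameLetters same

-- Compare a with b = g (f a), the excedance of g closed at f a.
excedance-value-≮ : ∀ {m f g} → IsIC321 m f → IsIC321 m g → SameLetters m f g →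
  ∀ a → a < m → excedance f a ≡ true →
  (∀ b → b < a → excedance f b ≡ true → f b ≡ g b) → f a < g a → ⊥
excedance-value-≮ {m} {f} {g} isF isG same a a<m e ih fa<ga = compare (<-cmp b a)
  where
  open SameLetters same
  module F = IC321 isF
  module G = IC321 isG
  fa<m : f a < m
  fa<m = F.bounded a a<m
  b : ℕ
  b = g (f a)
  g-b≡f-a : g b ≡ f a
  g-b≡f-a = G.involutive (f a) fa<m
  compare : Tri (b < a) (b ≡ a) (a < b) → ⊥
  compare (tri≈ _ b≡a _) = <-irrefl (trans (sym g-b≡f-a) (cong g b≡a)) fa<ga
  compare (tri< b<a _ _) = <⇒≢ b<a (F.injective (<-trans b<a a<m) a<m (trans (ih b b<a e-b) g-b≡f-a))
    where
    e-b : excedance f b ≡ true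
    e-b = trans (same-excedance b (<-trans b<a a<m))
            (trans (cong (b <ᵇ_) g-b≡f-a) (<⇒<ᵇ-true {n = f a} (<-trans b<a (<ᵇ-true⇒< e))))
  compare (tri> _ _ a<b) =
    <-asym fa<ga (subst (g a <_) g-b≡f-a (G.<-excedance⇒< a<b (G.bounded (f a) fa<m) e-b))
    where
    e-b : excedance g b ≡ true
    e-b = G.deficiency⇒excedance (f a) fa<m (trans (sym (same-deficiency (f a) fa<m)) (F.excedance⇒deficiency a a<m e))

excedance-values-agree : ∀ {m f g} → IsIC321 m f → IsIC321 m g → SameLetters m f g →
  ∀ a → a < m → excedance f a ≡ true → f a ≡ g a
excedance-values-agree {m} {f} {g} isF isG same = <-rec _ agree
  where
  open SameLetters same
  agree : ∀ a → (∀ {b} → b < a → b < m → excedance f b ≡ true → f b ≡ g b) →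
    a < m → excedance f a ≡ true → f a ≡ g a
  agree a ih a<m e with <-cmp (f a) (g a)
  ... | tri≈ _ fa≡ga _ = fa≡ga
  ... | tri< fa<ga _ _ = ⊥-elim (excedance-value-≮ isF isG same a a<m e
                           (λ b b<a → ih b<a (<-trans b<a a<m)) fa<ga)
  ... | tri> _ _ ga<fa = ⊥-elim (excedance-value-≮ isG isF (SameLetters-sym same) a a<m
                           (trans (sym (same-excedance a a<m)) e)
                           (λ b b<a e′ → sym (ih b<a (<-trans b<a a<m) (trans (same-excedance b (<-trans b<a a<m)) e′)))
                           ga<fa)

-- Deficiencies are images of excedances, and the remaining points are fixed.
letters-determine : ∀ {m f g} → IsIC321 m f → IsIC321 m g → SameLetters m f g →
  ∀ q → q < m → f q ≡ g q
letters-determine {m} {f} {g} isF isG same q q<m with excedance f q in e | deficiency f q in d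
... | true  | _     = excedance-values-agree isF isG same q q<m e
... | false | true  = begin
  f q         ≡⟨ sym (IsIC321.involutive isG (f q) fq<m) ⟩
  g (g (f q)) ≡⟨ cong g (sym (excedance-values-agree isF isG same (f q) fq<m (IC321.deficiency⇒excedance isF q q<m d))) ⟩
  g (f (f q)) ≡⟨ cong g (IsIC321.involutive isF q q<m) ⟩
  g q         ∎
  where
  open ≡-Reasoning
  fq<m : f q < m
  fq<m = IsIC321.bounded isF q q<m
... | false | false = trans (fixed-point f q e d) (sym (fixed-point g q
                        (trans (sym (same-excedance q q<m)) e) (trans (sym (same-deficiency q q<m)) d)))
  where open SameLetters same

deficiencies-agree : ∀ {m f g} → IsIC321 m f → IsIC321 m g → ∀ p → p ≤ m →
  (∀ q → q < p → excedance f q ≡ excedance g q) → ∀ q → q < p → deficiency f q ≡ deficiency g q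
deficiencies-agree {m} {f} {g} isF isG (suc p) sp≤m E q q<sp with m≤n⇒m<n∨m≡n (s≤s⁻¹ q<sp)
... | inj₁ q<p  = deficiencies-agree isF isG p (≤-trans (n≤1+n p) sp≤m) (λ r r<p → E r (m<n⇒m<1+n r<p)) q q<p
... | inj₂ refl with excedance f q in e
...   | true  = trans (excedance⇒¬deficiency f q e) (sym (excedance⇒¬deficiency g q (trans (sym (E q q<sp)) e)))
...   | false = begin
  deficiency f q                                  ≡⟨ IC321.deficiency-by-counts isF q sp≤m e ⟩
  (count (deficiency f) q <ᵇ count (excedance f) q) ≡⟨ cong₂ _<ᵇ_ (count-cong _ q earlier)
                                                               (count-cong _ q (λ r r<q → E r (m<n⇒m<1+n r<q))) ⟩
  (count (deficiency g) q <ᵇ count (excedance g) q) ≡⟨ sym (IC321.deficiency-by-counts isG q sp≤m (trans (sym (E q q<sp)) e)) ⟩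
  deficiency g q                                  ∎
  where
  open ≡-Reasoning
  earlier : ∀ r → r < q → deficiency f r ≡ deficiency g r
  earlier = deficiencies-agree isF isG q (≤-trans (n≤1+n q) sp≤m) (λ r r<q → E r (m<n⇒m<1+n r<q))

mirror-agree : ∀ n {P P′ Q Q′ : ℕ → Bool}
  → (∀ r → r < n + n → P (n + n ∸ suc r) ≡ Q r)
  → (∀ r → r < n + n → P′ (n + n ∸ suc r) ≡ Q′ r)
  → (∀ r → r < n → Q r ≡ Q′ r)
  → ∀ q → q < n + n → n ≤ q → P q ≡ P′ q
mirror-agree n {P} {P′} {Q} {Q′} P≡Q P′≡Q′ Q≡Q′ q q<2n n≤q = begin
  P q               ≡⟨ cong P (sym (∸-suc-involutive q<2n)) ⟩
  P (n + n ∸ suc r) ≡⟨ P≡Q r r<2n ⟩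
  Q r               ≡⟨ Q≡Q′ r (upper-half-mirror n≤q q<2n) ⟩
  Q′ r              ≡⟨ sym (P′≡Q′ r r<2n) ⟩
  P′ (n + n ∸ suc r) ≡⟨ cong P′ (∸-suc-involutive q<2n) ⟩
  P′ q              ∎
  where
  open ≡-Reasoning
  r : ℕ
  r = n + n ∸ suc q
  r<2n : r < n + n
  r<2n = ∸-suc-< q<2n

-- Centrosymmetry turns the letters on the upper half into the mirrored letters of the lower half.
lower-half-excedances-determine : ∀ n {f g} → IsIC321 (n + n) f → IsIC321 (n + n) g →
  (∀ q → q < n → excedance f q ≡ excedance g q) → ∀ q → q < n + n → f q ≡ g q
lower-half-excedances-determine n {f} {g} isF isG E = letters-determine isF isG record
  { same-excedance  = by-halves E (mirror-agree n (IC321.excedance-mirror isF) (IC321.excedance-mirror isG) D)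
  ; same-deficiency = by-halves D (mirror-agree n (IC321.deficiency-mirror isF) (IC321.deficiency-mirror isG) E)
  }
  where
  D : ∀ q → q < n → deficiency f q ≡ deficiency g q
  D = deficiencies-agree isF isG n (m≤m+n n n) E
  by-halves : ∀ {P P′ : ℕ → Bool} →
    (∀ q → q < n → P q ≡ P′ q) → (∀ q → q < n + n → n ≤ q → P q ≡ P′ q) →
    ∀ q → q < n + n → P q ≡ P′ q
  by-halves lower upper q q<2n with q <? n
  ... | yes q<n = lower q q<n
  ... | no  q≮n = upper q q<2n (≮⇒≥ q≮n)

-- Matching a symmetric ballot word

module MirrorCounts (m : ℕ) (U D : ℕ → Bool) (U-mirror : ∀ q → q < m → U q ≡ D (m ∸ suc q)) where

  D-mirror : ∀ q → q < m → D q ≡ U (m ∸ suc q)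
  D-mirror q q<m = trans (cong D (sym (∸-suc-involutive q<m))) (sym (U-mirror _ (∸-suc-< q<m)))

  count-U+D : ∀ k → k ≤ m → count U k + count D (m ∸ k) ≡ count D m
  count-U+D = count-mirror U D m U-mirror

  count-D+U : ∀ k → k ≤ m → count D k + count U (m ∸ k) ≡ count U m
  count-D+U = count-mirror D U m D-mirror

  balanced : count U m ≡ count D m
  balanced = begin
    count U m                   ≡⟨ sym (+-identityʳ _) ⟩
    count U m + count D 0       ≡⟨ cong (λ x → count U m + count D x) (sym (n∸n≡0 m)) ⟩
    count U m + count D (m ∸ m) ≡⟨ count-U+D m ≤-refl ⟩
    count D m                   ∎
    where open ≡-Reasoning

  complementary : ∀ {x y} → x < m → y < m → count U (suc x) ≡ count D (suc y) →
    count D (m ∸ suc x) ≡ count U (m ∸ suc y)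
  complementary {x} {y} x<m y<m eq = +-cancelˡ-≡ (count U (suc x)) _ _ (begin
    count U (suc x) + count D (m ∸ suc x) ≡⟨ count-U+D (suc x) x<m ⟩
    count D m                             ≡⟨ sym balanced ⟩
    count U m                             ≡⟨ sym (count-D+U (suc y) y<m) ⟩
    count D (suc y) + count U (m ∸ suc y) ≡⟨ cong (_+ count U (m ∸ suc y)) (sym eq) ⟩
    count U (suc x) + count U (m ∸ suc y) ∎)
    where open ≡-Reasoning

-- The k-th up-step of a ballot word is matched with its k-th down-step.
module Matching
    (m : ℕ) (U D : ℕ → Bool)
    (U-mirror  : ∀ q → q < m → U q ≡ D (m ∸ suc q))
    (U⇒¬D      : ∀ q → U q ≡ true → D q ≡ false)
    (D≤U       : ∀ p → p < m → count D p ≤ count U p)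
    (D⇒D<U     : ∀ p → p < m → D p ≡ true → count D p < count U p)
    (flat⇒D≡U  : ∀ p → p < m → U p ≡ false → D p ≡ false → count D p ≡ count U p)
  where
  open MirrorCounts m U D U-mirror

  D⇒¬U : ∀ q → D q ≡ true → U q ≡ false
  D⇒¬U q d with U q in u
  ... | false = refl
  ... | true  = ⊥-elim (true≢false (trans (sym d) (U⇒¬D q u)))

  data Letter (p : ℕ) : Set where
    up   : U p ≡ true → Letter p
    down : U p ≡ false → D p ≡ true → Letter p
    flat : U p ≡ false → D p ≡ false → Letter p

  letter : ∀ p → Letter p
  letter p with U p in u | D p in d
  ... | true  | _     = up u
  ... | false | true  = down u d
  ... | false | false = flat u d

  match : ℕ → ℕ
  match p = if U p then nth D (count U p) m else if D p then nth U (count D p) m else p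

  match-flat : ∀ {p} → U p ≡ false → D p ≡ false → match p ≡ p
  match-flat u d rewrite u | d = refl

  up-partner : ∀ p → p < m → U p ≡ true → IsNth D (count U p) m (match p)
  up-partner p p<m u rewrite u = nth-isNth D (count U p) m (subst (count U p <_) balanced (count-< U p<m u))

  down-partner : ∀ p → p < m → U p ≡ false → D p ≡ true → IsNth U (count D p) m (match p)
  down-partner p p<m u d rewrite u | d = nth-isNth U (count D p) m (subst (count D p <_) (sym balanced) (count-< D p<m d))

  match-< : ∀ p → p < m → match p < m
  match-< p p<m with letter p
  ... | up u     = IsNth.bounded (up-partner p p<m u)
  ... | down u d = IsNth.bounded (down-partner p p<m u d)
  ... | flat u d = subst (_< m) (sym (match-flat u d)) p<m

  match-involutive : ∀ p → p < m → match (match p) ≡ p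
  match-involutive p p<m with letter p
  ... | up u = count-injective U (IsNth.holds back) u (trans (IsNth.rank back) (IsNth.rank there))
    where
    there : IsNth D (count U p) m (match p)
    there = up-partner p p<m u
    back : IsNth U (count D (match p)) m (match (match p))
    back  = down-partner (match p) (IsNth.bounded there) (D⇒¬U _ (IsNth.holds there)) (IsNth.holds there)
  ... | down u d = count-injective D (IsNth.holds back) d (trans (IsNth.rank back) (IsNth.rank there))
    where
    there : IsNth U (count D p) m (match p)
    there = down-partner p p<m u d
    back : IsNth D (count U (match p)) m (match (match p))
    back  = up-partner (match p) (IsNth.bounded there) (IsNth.holds there)
  ... | flat u d = trans (cong match (match-flat u d)) (match-flat u d)

  up-exceeds : ∀ p → p < m → U p ≡ true → p < match p
  up-exceeds p p<m u =
    ≤∧≢⇒< (count-≤⇒≤ D (IsNth.holds there) (subst (count D p ≤_) (sym (IsNth.rank there)) (D≤U p p<m)))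
    (λ p≡q → true≢false (trans (sym (IsNth.holds there)) (trans (cong D (sym p≡q)) (U⇒¬D p u))))
    where
    there : IsNth D (count U p) m (match p)
    there = up-partner p p<m u

  down-recedes : ∀ p → p < m → U p ≡ false → D p ≡ true → match p < p
  down-recedes p p<m u d = count-<⇒< U (subst (_< count U p) (sym (IsNth.rank (down-partner p p<m u d))) (D⇒D<U p p<m d))

  match-excedance : ∀ p → p < m → excedance match p ≡ U p
  match-excedance p p<m with letter p
  ... | up u     = trans (<⇒<ᵇ-true (up-exceeds p p<m u)) (sym u)
  ... | down u d = trans (≥⇒<ᵇ-false (<⇒≤ (down-recedes p p<m u d))) (sym u)
  ... | flat u d = trans (cong (p <ᵇ_) (match-flat u d)) (trans (≥⇒<ᵇ-false {p} ≤-refl) (sym u))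

  match-mirror-up : ∀ p → p < m → U p ≡ true → match (m ∸ suc p) ≡ m ∸ suc (match p)
  match-mirror-up p p<m u = count-injective U (IsNth.holds mirrored) u′ (trans (IsNth.rank mirrored) ranks)
    where
    there : IsNth D (count U p) m (match p)
    there = up-partner p p<m u
    d′ : D (m ∸ suc p) ≡ true
    d′ = trans (D-mirror _ (∸-suc-< p<m)) (trans (cong U (∸-suc-involutive p<m)) u)
    mirrored : IsNth U (count D (m ∸ suc p)) m (match (m ∸ suc p))
    mirrored = down-partner (m ∸ suc p) (∸-suc-< p<m) (D⇒¬U _ d′) d′
    u′ : U (m ∸ suc (match p)) ≡ true
    u′ = trans (U-mirror _ (∸-suc-< (IsNth.bounded there)))
               (trans (cong D (∸-suc-involutive (IsNth.bounded there))) (IsNth.holds there))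
    ranks : count D (m ∸ suc p) ≡ count U (m ∸ suc (match p))
    ranks = complementary p<m (IsNth.bounded there)
      (trans (count-true U u) (sym (trans (count-true D (IsNth.holds there)) (cong suc (IsNth.rank there)))))

  match-centrosymmetric : ∀ p → p < m → match (m ∸ suc p) ≡ m ∸ suc (match p)
  match-centrosymmetric p p<m with letter p
  ... | up u     = match-mirror-up p p<m u
  ... | down u d = begin
    match (m ∸ suc p)                 ≡⟨ cong match (sym mirrored) ⟩
    match (match (m ∸ suc (match p))) ≡⟨ match-involutive _ (∸-suc-< (IsNth.bounded there)) ⟩
    m ∸ suc (match p)                 ∎
    where
    open ≡-Reasoning
    there : IsNth U (count D p) m (match p)
    there = down-partner p p<m u d
    mirrored : match (m ∸ suc (match p)) ≡ m ∸ suc p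
    mirrored = trans (match-mirror-up (match p) (IsNth.bounded there) (IsNth.holds there))
                     (cong (λ x → m ∸ suc x) (match-involutive p p<m))
  ... | flat u d = trans (match-flat u′ d′) (cong (λ x → m ∸ suc x) (sym (match-flat u d)))
    where
    u′ : U (m ∸ suc p) ≡ false
    u′ = trans (U-mirror _ (∸-suc-< p<m)) (trans (cong D (∸-suc-involutive p<m)) d)
    d′ : D (m ∸ suc p) ≡ false
    d′ = trans (D-mirror _ (∸-suc-< p<m)) (trans (cong U (∸-suc-involutive p<m)) u)

  flat-before-down : ∀ x y → x < y → y < m →
    U x ≡ false → D x ≡ false → U y ≡ false → D y ≡ true → x < match y
  flat-before-down x y x<y y<m u d u′ d′ = ≤∧≢⇒< (count-≤⇒≤ U (IsNth.holds there) counts)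
    (λ x≡a → true≢false (trans (sym (IsNth.holds there)) (trans (cong U (sym x≡a)) u)))
    where
    there : IsNth U (count D y) m (match y)
    there = down-partner y y<m u′ d′
    counts : count U x ≤ count U (match y)
    counts = subst₂ _≤_ (flat⇒D≡U x (<-trans x<y y<m) u d) (sym (IsNth.rank there)) (count-mono D (<⇒≤ x<y))

  match-increasing : ∀ x y → x < y → y < m → U x ≡ U y → match x < match y
  match-increasing x y x<y y<m same with letter x | letter y
  ... | up u | up u′ = count-<⇒< D (subst₂ _<_ (sym (IsNth.rank (up-partner x x<m u)))
                                               (sym (IsNth.rank (up-partner y y<m u′))) (count-< U x<y u))
    where
    x<m : x < m
    x<m = <-trans x<y y<m
  ... | down u d | down u′ d′ = count-<⇒< U (subst₂ _<_ (sym (IsNth.rank (down-partner x x<m u d)))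
                                                        (sym (IsNth.rank (down-partner y y<m u′ d′))) (count-< D x<y d))
    where
    x<m : x < m
    x<m = <-trans x<y y<m
  ... | flat u d | flat u′ d′ = subst₂ _<_ (sym (match-flat u d)) (sym (match-flat u′ d′)) x<y
  ... | down u d | flat u′ d′ =
    subst (match x <_) (sym (match-flat u′ d′)) (<-trans (down-recedes x (<-trans x<y y<m) u d) x<y)
  ... | flat u d | down u′ d′ = subst (_< match y) (sym (match-flat u d)) (flat-before-down x y x<y y<m u d u′ d′)
  ... | up u | down u′ _ = ⊥-elim (true≢false (trans (sym u) (trans same u′)))
  ... | up u | flat u′ _ = ⊥-elim (true≢false (trans (sym u) (trans same u′)))
  ... | down u _ | up u′ = ⊥-elim (true≢false (trans (sym u′) (trans (sym same) u)))
  ... | flat u _ | up u′ = ⊥-elim (true≢false (trans (sym u′) (trans (sym same) u)))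

  -- Two of any three positions carry the same U-letter, and match increases along each letter.
  match-avoids-321 : ∀ i j k → i < j → j < k → k < m → match j < match i → match k < match j → ⊥
  match-avoids-321 i j k i<j j<k k<m mj<mi mk<mj with U i B.≟ U j | U j B.≟ U k
  ... | yes same | _        = <-asym (match-increasing i j i<j (<-trans j<k k<m) same) mj<mi
  ... | no _     | yes same = <-asym (match-increasing j k j<k k<m same) mk<mj
  ... | no i≢j   | no j≢k   =
    <-asym (match-increasing i k (<-trans i<j j<k) k<m (bool-pigeonhole i≢j j≢k)) (<-trans mk<mj mj<mi)

  match-IsIC321 : IsIC321 m match
  match-IsIC321 = record
    { bounded = match-< ; involutive = match-involutive
    ; centrosymmetric = match-centrosymmetric ; avoids-321 = match-avoids-321 }

-- The word reads S as up-steps on [0, n), a non-member becomes a down-step exactly when an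
-- up-step is pending (height > 0), and [n, 2n) is the mirror image with up and down exchanged.
module FromSubset (n : ℕ) (S : ℕ → Bool) where
  m : ℕ
  m = n + n

  height : ℕ → ℕ
  height zero    = zero
  height (suc q) = if S q then suc (height q) else pred (height q)

  closes : ℕ → Bool
  closes q = not (S q) ∧ (0 <ᵇ height q)

  U D : ℕ → Bool
  U q = if q <ᵇ n then S q else closes (m ∸ suc q)
  D q = if q <ᵇ n then closes q else S (m ∸ suc q)

  U-mirror : ∀ q → q < m → U q ≡ D (m ∸ suc q)
  U-mirror q q<m with q <ᵇ n in e
  ... | true  rewrite ≥⇒<ᵇ-false (lower-half-mirror (<ᵇ-true⇒< {q} {n} e)) | ∸-suc-involutive q<m = refl
  ... | false rewrite <⇒<ᵇ-true (upper-half-mirror (<ᵇ-false⇒≥ {q} {n} e) q<m) = refl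

  U⇒¬D : ∀ q → U q ≡ true → D q ≡ false
  U⇒¬D q u with q <ᵇ n
  ... | true  rewrite u = refl
  ... | false with S (m ∸ suc q)
  ...   | false = refl
  ...   | true  = ⊥-elim (true≢false (sym u))

  open MirrorCounts m U D U-mirror

  height-lower-half : ∀ p → p ≤ n → count U p ≡ count D p + height p
  height-lower-half zero    _    = refl
  height-lower-half (suc p) p<n with height-lower-half p (≤-trans (n≤1+n p) p<n)
  ... | ih rewrite <⇒<ᵇ-true p<n with S p
  ...   | true = trans (cong (_+ 1) ih)
                   (solve 2 (λ a b → a :+ b :+ con 1 := a :+ con 0 :+ (con 1 :+ b)) refl (count D p) (height p))
    where open +-*-Solver
  ...   | false with height p
  ...     | zero  = cong (_+ 0) ih
  ...     | suc h = trans (cong (_+ 0) ih)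
                      (solve 2 (λ a b → a :+ (con 1 :+ b) :+ con 0 := a :+ con 1 :+ b) refl (count D p) h)
    where open +-*-Solver

  closes⇒height>0 : ∀ q → closes q ≡ true → 0 < height q
  closes⇒height>0 q c = <ᵇ-true⇒< (∧-trueʳ {not (S q)} c)

  unclosed-height : ∀ q → S q ≡ false → closes q ≡ false → height q ≡ 0
  unclosed-height q s c rewrite s = n≤0⇒n≡0 (<ᵇ-false⇒≥ {0} c)

  excess : ℕ → ℕ
  excess p = if p <ᵇ n then height p else height (m ∸ p)

  -- By the mirror symmetry of the word, the height at p ≥ n is the lower-half height at m ∸ p.
  U≡D+excess : ∀ p → p < m → count U p ≡ count D p + excess p
  U≡D+excess p p<m with p <ᵇ n in e
  ... | true  = height-lower-half p (<⇒≤ (<ᵇ-true⇒< {p} {n} e))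
  ... | false = +-cancelʳ-≡ (count D (m ∸ p)) _ _ (begin
    count U p + count D (m ∸ p)                    ≡⟨ count-U+D p (<⇒≤ p<m) ⟩
    count D m                                      ≡⟨ sym balanced ⟩
    count U m                                      ≡⟨ sym (count-D+U p (<⇒≤ p<m)) ⟩
    count D p + count U (m ∸ p)                    ≡⟨ cong (count D p +_) (height-lower-half (m ∸ p) m-p≤n) ⟩
    count D p + (count D (m ∸ p) + height (m ∸ p)) ≡⟨ cong (count D p +_) (+-comm _ (height (m ∸ p))) ⟩
    count D p + (height (m ∸ p) + count D (m ∸ p)) ≡⟨ sym (+-assoc (count D p) _ _) ⟩
    count D p + height (m ∸ p) + count D (m ∸ p)   ∎)
    where
    open ≡-Reasoning
    m-p≤n : m ∸ p ≤ n
    m-p≤n = ≤-trans (∸-monoʳ-≤ m (<ᵇ-false⇒≥ {p} {n} e)) (≤-reflexive (m+n∸n≡m n n))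

  D⇒excess>0 : ∀ p → p < m → D p ≡ true → 0 < excess p
  D⇒excess>0 p p<m d with p <ᵇ n
  ... | true  = closes⇒height>0 p d
  ... | false rewrite ∸≡suc∸suc p<m | d = z<s

  flat⇒excess≡0 : ∀ p → p < m → U p ≡ false → D p ≡ false → excess p ≡ 0
  flat⇒excess≡0 p p<m u d with p <ᵇ n
  ... | true  = unclosed-height p u d
  ... | false = begin
    height (m ∸ p)                                       ≡⟨ cong height (∸≡suc∸suc p<m) ⟩
    (if S r then suc (height r) else pred (height r))    ≡⟨ cong (λ b → if b then suc (height r) else pred (height r)) d ⟩
    pred (height r)                                      ≡⟨ cong pred (unclosed-height r d u) ⟩
    0                                                    ∎
    where
    open ≡-Reasoning
    r : ℕ
    r = m ∸ suc p

  private
    module M = Matching m U D U-mirror U⇒¬D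
      (λ p p<m → subst (count D p ≤_) (sym (U≡D+excess p p<m)) (m≤m+n _ _))
      (λ p p<m d → subst (count D p <_) (sym (U≡D+excess p p<m)) (m<m+n _ (D⇒excess>0 p p<m d)))
      (λ p p<m u d → sym (trans (U≡D+excess p p<m)
                                (trans (cong (count D p +_) (flat⇒excess≡0 p p<m u d)) (+-identityʳ _))))
  open M public using (match; match-IsIC321)

  match-lower-excedances : ∀ p → p < n → excedance match p ≡ S p
  match-lower-excedances p p<n = trans (M.match-excedance p (≤-trans p<n (m≤m+n n n)))
    (cong (λ b → if b then S p else closes (m ∸ suc p)) (<⇒<ᵇ-true p<n))

lower-half-excedances-realisable : ∀ n (S : ℕ → Bool) →
  ∃[ f ] (IsIC321 (n + n) f × (∀ p → p < n → excedance f p ≡ S p))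
lower-half-excedances-realisable n S = match , match-IsIC321 , match-lower-excedances
  where open FromSubset n S

-- Permutations of Fin m

onℕ : ∀ {m} → Permutation′ m → ℕ → ℕ
onℕ {m} π q with q <? m
... | yes q<m = toℕ (π ⟨$⟩ʳ fromℕ< q<m)
... | no  _   = q

onℕ-toℕ : ∀ {m} (π : Permutation′ m) i → onℕ π (toℕ i) ≡ toℕ (π ⟨$⟩ʳ i)
onℕ-toℕ {m} π i with toℕ i <? m
... | yes i<m = cong (λ j → toℕ (π ⟨$⟩ʳ j)) (fromℕ<-toℕ i i<m)
... | no  i≮m = ⊥-elim (i≮m (toℕ<n i))

onℕ-fromℕ< : ∀ {m} (π : Permutation′ m) {q} (q<m : q < m) → onℕ π q ≡ toℕ (π ⟨$⟩ʳ fromℕ< q<m)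
onℕ-fromℕ< π q<m = trans (cong (onℕ π) (sym (toℕ-fromℕ< q<m))) (onℕ-toℕ π (fromℕ< q<m))

InIC321⇒IsIC321 : ∀ {m} (π : Permutation′ m) → InIC321 π → IsIC321 m (onℕ π)
InIC321⇒IsIC321 {m} π (centro , invol , avoids) = record
  { bounded         = λ q q<m → subst (_< m) (sym (onℕ-fromℕ< π q<m)) (toℕ<n _)
  ; involutive      = involutive
  ; centrosymmetric = centrosymmetric
  ; avoids-321      = avoids-321
  }
  where
  open ≡-Reasoning
  involutive : ∀ q → q < m → onℕ π (onℕ π q) ≡ q
  involutive q q<m = begin
    onℕ π (onℕ π q)                      ≡⟨ cong (onℕ π) (onℕ-fromℕ< π q<m) ⟩
    onℕ π (toℕ (π ⟨$⟩ʳ fromℕ< q<m))     ≡⟨ onℕ-toℕ π _ ⟩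
    toℕ (π ⟨$⟩ʳ (π ⟨$⟩ʳ fromℕ< q<m))    ≡⟨ cong toℕ (invol (fromℕ< q<m)) ⟩
    toℕ (fromℕ< q<m)                      ≡⟨ toℕ-fromℕ< q<m ⟩
    q                                     ∎
  centrosymmetric : ∀ q → q < m → onℕ π (m ∸ suc q) ≡ m ∸ suc (onℕ π q)
  centrosymmetric q q<m = begin
    onℕ π (m ∸ suc q)            ≡⟨ cong (λ x → onℕ π (m ∸ suc x)) (sym (toℕ-fromℕ< q<m)) ⟩
    onℕ π (m ∸ suc (toℕ i))      ≡⟨ cong (onℕ π) (sym (opposite-prop i)) ⟩
    onℕ π (toℕ (opposite i))     ≡⟨ onℕ-toℕ π (opposite i) ⟩
    toℕ (π ⟨$⟩ʳ opposite i)      ≡⟨ cong toℕ (centro i) ⟩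
    toℕ (opposite (π ⟨$⟩ʳ i))    ≡⟨ opposite-prop _ ⟩
    m ∸ suc (toℕ (π ⟨$⟩ʳ i))     ≡⟨ cong (λ x → m ∸ suc x) (sym (onℕ-fromℕ< π q<m)) ⟩
    m ∸ suc (onℕ π q)            ∎
    where
    i : Fin m
    i = fromℕ< q<m
  avoids-321 : ∀ i j k → i < j → j < k → k < m → onℕ π j < onℕ π i → onℕ π k < onℕ π j → _
  avoids-321 i j k i<j j<k k<m πj<πi πk<πj = avoids
    ( fromℕ< i<m , fromℕ< j<m , fromℕ< k<m
    , subst₂ _<_ (sym (toℕ-fromℕ< i<m)) (sym (toℕ-fromℕ< j<m)) i<j
    , subst₂ _<_ (sym (toℕ-fromℕ< j<m)) (sym (toℕ-fromℕ< k<m)) j<k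
    , subst₂ _<_ (onℕ-fromℕ< π j<m) (onℕ-fromℕ< π i<m) πj<πi
    , subst₂ _<_ (onℕ-fromℕ< π k<m) (onℕ-fromℕ< π j<m) πk<πj )
    where
    j<m : j < m
    j<m = <-trans j<k k<m
    i<m : i < m
    i<m = <-trans i<j j<m

toPermutation : ∀ {m f} → IsIC321 m f → Permutation′ m
toPermutation {m} {f} isF = permutation F F F∘F F∘F
  where
  F : Fin m → Fin m
  F i = fromℕ< (IsIC321.bounded isF (toℕ i) (toℕ<n i))
  F∘F : ∀ i → F (F i) ≡ i
  F∘F i = toℕ-injective (trans (toℕ-fromℕ< _)
    (trans (cong f (toℕ-fromℕ< _)) (IsIC321.involutive isF (toℕ i) (toℕ<n i))))

toℕ-toPermutation : ∀ {m f} (isF : IsIC321 m f) i → toℕ (toPermutation isF ⟨$⟩ʳ i) ≡ f (toℕ i)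
toℕ-toPermutation isF i = toℕ-fromℕ< _

IsIC321⇒InIC321 : ∀ {m f} (isF : IsIC321 m f) → InIC321 (toPermutation isF)
IsIC321⇒InIC321 {m} {f} isF = centro , invol , avoids
  where
  π : Permutation′ m
  π = toPermutation isF
  open ≡-Reasoning
  centro : ∀ i → π ⟨$⟩ʳ opposite i ≡ opposite (π ⟨$⟩ʳ i)
  centro i = toℕ-injective (begin
    toℕ (π ⟨$⟩ʳ opposite i)     ≡⟨ toℕ-toPermutation isF (opposite i) ⟩
    f (toℕ (opposite i))        ≡⟨ cong f (opposite-prop i) ⟩
    f (m ∸ suc (toℕ i))         ≡⟨ IsIC321.centrosymmetric isF (toℕ i) (toℕ<n i) ⟩
    m ∸ suc (f (toℕ i))         ≡⟨ cong (λ x → m ∸ suc x) (sym (toℕ-toPermutation isF i)) ⟩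
    m ∸ suc (toℕ (π ⟨$⟩ʳ i))    ≡⟨ sym (opposite-prop _) ⟩
    toℕ (opposite (π ⟨$⟩ʳ i))   ∎)
  invol : ∀ i → π ⟨$⟩ʳ (π ⟨$⟩ʳ i) ≡ i
  invol i = toℕ-injective (trans (toℕ-toPermutation isF _)
    (trans (cong f (toℕ-toPermutation isF i)) (IsIC321.involutive isF (toℕ i) (toℕ<n i))))
  avoids : Avoids321 π
  avoids (i , j , k , i<j , j<k , πj<πi , πk<πj) = IsIC321.avoids-321 isF (toℕ i) (toℕ j) (toℕ k) i<j j<k (toℕ<n k)
    (subst₂ _<_ (toℕ-toPermutation isF j) (toℕ-toPermutation isF i) πj<πi)
    (subst₂ _<_ (toℕ-toPermutation isF k) (toℕ-toPermutation isF j) πk<πj)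

lookup-Eπ : ∀ n (π : Permutation′ (n + n)) (i : Fin n) → lookup (Eπ n π) i ≡ excedance (onℕ π) (toℕ i)
lookup-Eπ n π i = begin
  lookup (Eπ n π) i                          ≡⟨ lookup∘tabulate _ i ⟩
  (toℕ (i ↑ˡ n) <ᵇ toℕ (π ⟨$⟩ʳ (i ↑ˡ n)))   ≡⟨ cong₂ _<ᵇ_ (toℕ-↑ˡ i n) (sym (onℕ-toℕ π (i ↑ˡ n))) ⟩
  (toℕ i <ᵇ onℕ π (toℕ (i ↑ˡ n)))           ≡⟨ cong (λ x → toℕ i <ᵇ onℕ π x) (toℕ-↑ˡ i n) ⟩
  excedance (onℕ π) (toℕ i)                  ∎
  where open ≡-Reasoning

Eπ-toPermutation : ∀ n {f} (isF : IsIC321 (n + n) f) (S : Subset n) →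
  (∀ i → excedance f (toℕ i) ≡ lookup S i) → Eπ n (toPermutation isF) ≡ S
Eπ-toPermutation n {f} isF S exc = trans (tabulate-cong at) (tabulate∘lookup S)
  where
  at : ∀ i → (toℕ (i ↑ˡ n) <ᵇ toℕ (toPermutation isF ⟨$⟩ʳ (i ↑ˡ n))) ≡ lookup S i
  at i = trans (cong₂ _<ᵇ_ (toℕ-↑ˡ i n) (trans (toℕ-toPermutation isF (i ↑ˡ n)) (cong f (toℕ-↑ˡ i n)))) (exc i)

memberℕ : ∀ {k} → Vec Bool k → ℕ → Bool
memberℕ []       _       = false
memberℕ (b ∷ bs) zero    = b
memberℕ (b ∷ bs) (suc q) = memberℕ bs q

memberℕ-toℕ : ∀ {k} (bs : Vec Bool k) (i : Fin k) → memberℕ bs (toℕ i) ≡ lookup bs i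
memberℕ-toℕ (b ∷ bs) Fin.zero    = refl
memberℕ-toℕ (b ∷ bs) (Fin.suc i) = memberℕ-toℕ bs i

Eπ-injective : ∀ n (π σ : Permutation′ (n + n)) → InIC321 π → InIC321 σ →
  Eπ n π ≡ Eπ n σ → ∀ i → π ⟨$⟩ʳ i ≡ σ ⟨$⟩ʳ i
Eπ-injective n π σ π∈ σ∈ Eπ≡Eσ i = toℕ-injective (begin
  toℕ (π ⟨$⟩ʳ i) ≡⟨ sym (onℕ-toℕ π i) ⟩
  onℕ π (toℕ i)  ≡⟨ lower-half-excedances-determine n (InIC321⇒IsIC321 π π∈) (InIC321⇒IsIC321 σ σ∈)
                      same-excedances (toℕ i) (toℕ<n i) ⟩
  onℕ σ (toℕ i)  ≡⟨ onℕ-toℕ σ i ⟩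
  toℕ (σ ⟨$⟩ʳ i) ∎)
  where
  open ≡-Reasoning
  same-excedances : ∀ q → q < n → excedance (onℕ π) q ≡ excedance (onℕ σ) q
  same-excedances q q<n = begin
    excedance (onℕ π) q                   ≡⟨ cong (excedance (onℕ π)) (sym (toℕ-fromℕ< q<n)) ⟩
    excedance (onℕ π) (toℕ (fromℕ< q<n)) ≡⟨ sym (lookup-Eπ n π _) ⟩
    lookup (Eπ n π) (fromℕ< q<n)          ≡⟨ cong (λ E → lookup E (fromℕ< q<n)) Eπ≡Eσ ⟩
    lookup (Eπ n σ) (fromℕ< q<n)          ≡⟨ lookup-Eπ n σ _ ⟩
    excedance (onℕ σ) (toℕ (fromℕ< q<n)) ≡⟨ cong (excedance (onℕ σ)) (toℕ-fromℕ< q<n) ⟩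
    excedance (onℕ σ) q                   ∎

Eπ-surjective : ∀ n (S : Subset n) → ∃[ π ] (InIC321 π × Eπ n π ≡ S)
Eπ-surjective n S with lower-half-excedances-realisable n (memberℕ S)
... | f , isF , exc = toPermutation isF , IsIC321⇒InIC321 isF ,
  Eπ-toPermutation n isF S (λ i → trans (exc (toℕ i) (toℕ<n i)) (memberℕ-toℕ S i))

theorem3p5 : (n : ℕ) → 1 ≤ n →
    ((π σ : Permutation′ (n + n)) → InIC321 π → InIC321 σ →
      Eπ n π ≡ Eπ n σ → ∀ i → π ⟨$⟩ʳ i ≡ σ ⟨$⟩ʳ i)
    × ((S : Subset n) → ∃[ π ] (InIC321 π × Eπ n π ≡ S))
theorem3p5 n _ = Eπ-injective n , Eπ-surjective n
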